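{- An outerplanar graph $G$ is cop-win if and only if $G$ is connected and chordal.
   Context: A graph is chordal if it has no induced cycle of length greater than $3$. A graph is cop-win if a single cop has a strategy guaranteeing capture of the robber in the game of Cops and Robbers: the cop first chooses a vertex, then the robber chooses a vertex; in each round the cop moves to an adjacent vertex or stays, then the robber does likewise; perfect information; capture occurs when the cop occupies the robber's vertex. -}

module Defs where

open import Data.Nat using (ℕ; zero; suc; _≤_)
open import Data.Fin using (Fin; toℕ; _<_)
open import Data.Product using (Σ; _×_; _,_)
open import Data.Sum using (_⊎_)
open import Relation.Nullary using (¬_; Dec)
open import Relation.Binary.PropositionalEquality using (_≡_)
open import Function.Definitions using (Injective)
open import Function.Bundles using (_⇔_)

record Graph (n : ℕ) : Set₁ where
  field
    Adj     : Fin n → Fin n → Set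
    adj?    : (u v : Fin n) → Dec (Adj u v)
    symAdj  : ∀ {u v} → Adj u v → Adj v u
    irrefl  : ∀ {u} → ¬ Adj u u
open Graph public

data Reach {n : ℕ} (G : Graph n) : Fin n → Fin n → Set where
  here : ∀ {u} → Reach G u u
  step : ∀ {u w v} → Adj G u w → Reach G w v → Reach G u v

Connected : ∀ {n} → Graph n → Set
Connected G = ∀ u v → Reach G u v

Succ : (k : ℕ) → Fin k → Fin k → Set
Succ k i j = (suc (toℕ i) ≡ toℕ j) ⊎ ((suc (toℕ i) ≡ k) × (toℕ j ≡ 0))

CycAdj : (k : ℕ) → Fin k → Fin k → Set
CycAdj k i j = Succ k i j ⊎ Succ k j i

IsInducedCycle : ∀ {n} → Graph n → (k : ℕ) → (Fin k → Fin n) → Set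
IsInducedCycle G k f =
  Injective _≡_ _≡_ f × (∀ i j → Adj G (f i) (f j) ⇔ CycAdj k i j)

Chordal : ∀ {n} → Graph n → Set
Chordal {n} G = ∀ (k : ℕ) → 4 ≤ k → (f : Fin k → Fin n) → ¬ IsInducedCycle G k f

-- Outerplanar: there is a placement of the vertices in convex position
-- (a cyclic/linear order pos) such that no two edges cross, i.e. no edges
-- ab, cd with pos a < pos c < pos b < pos d.
Outerplanar : ∀ {n} → Graph n → Set
Outerplanar {n} G =
  Σ (Fin n → Fin n) λ pos → Injective _≡_ _≡_ pos ×
    (∀ a b c d → Adj G a b → Adj G c d →
       ¬ ((pos a < pos c) × (pos c < pos b) × (pos b < pos d)))

-- Cops and robbers, one cop.  CopWinsFrom G c r : cop on c, robber on r,
-- cop to move, and the cop can force capture (finite, well-founded play).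
data CopWinsFrom {n : ℕ} (G : Graph n) : Fin n → Fin n → Set where
  caught : ∀ {c r} → c ≡ r → CopWinsFrom G c r
  move   : ∀ {c r} (c' : Fin n) → (c' ≡ c ⊎ Adj G c c') →
           (c' ≡ r ⊎ ((r' : Fin n) → (r' ≡ r ⊎ Adj G r r') → CopWinsFrom G c' r')) →
           CopWinsFrom G c r

CopWin : ∀ {n} → Graph n → Set
CopWin {n} G = Σ (Fin n) λ c → (r : Fin n) → CopWinsFrom G c r

module Submission where

-- A cop who wins can reach a robber who never moves, so G is connected.  On an
-- induced cycle C of length at least four the robber survives by staying on C
-- outside the cop's closed neighbourhood: a cop adjacent to the robber's vertex
-- x cannot also watch both neighbours of x on C, because on C that needs a
-- chord, and off C the cop, x, its two neighbours and the rest of C form a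
-- subdivided K₄, which has no outerplanar drawing.
--
-- Conversely, if every nonempty induced subgraph without isolated vertices has
-- a vertex v dominated by some u ≠ v (N[v] ⊆ N[u]), the cop wins by induction:
-- he plays on G - v against the robber's shadow, which is u whenever the robber
-- is on v.  To find v, take an edge ab of the outerplanar drawing that spans
-- the fewest positions among the edges spanning some vertex.  Every other edge
-- between a and b then joins vertices that are consecutive in the drawing, so
-- walking from a towards b either meets a missing edge, next to which some
-- vertex has a single neighbour, or returns to a along ab: through a triangle
-- whose apex is dominated by a, or through an induced cycle, which chordality
-- excludes.  If no edge spans a vertex, the leftmost vertex has a single
-- neighbour.

open import Defs
open import Data.Nat using (ℕ; zero; suc; _+_; _∸_; _≤_; _<_; z≤n; s≤s; _<ᵇ_; _<?_; _≤?_; NonZero; >-nonZero)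
open import Data.Nat.Properties
open import Data.Nat.DivMod
  using (_%_; _mod_; m%n<n; m<n⇒m%n≡m; %-congˡ; [m+n]%n≡m%n; %-distribˡ-+; m%n%n≡m%n; n%n≡0; m≤n⇒[n∸m]%m≡n%m)
open import Data.Nat.Induction using (<-wellFounded)
open import Data.Bool using (Bool; true; false; not; _xor_)
open import Data.Bool.Properties using (xor-comm; xor-same) renaming (_≟_ to _≟ᵇ_)
open import Data.Bool.Solver using (module xor-∧-Solver)
open import Data.Fin using (Fin; toℕ; fromℕ<) renaming (zero to fzero; suc to fsuc)
open import Data.Fin.Properties using (toℕ-injective; toℕ<n; toℕ-fromℕ<; any?) renaming (_≟_ to _≟ᶠ_)
open import Data.Fin.Subset using (Subset; inside; outside; _∈_; _∉_; ⊤; _-_; ⁅_⁆; ∣_∣)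
open import Data.Fin.Subset.Properties using (∈⊤; _∈?_; x∈p∧x≢y⇒x∈p-y; p─q⊆p; x∈p⇒∣p-x∣<∣p∣)
open import Data.Vec using (_∷_; there)
open import Data.Product using (∃-syntax; _×_; _,_; proj₁; proj₂)
open import Data.Sum using (_⊎_; inj₁; inj₂; [_,_]; swap)
open import Data.Empty using (⊥; ⊥-elim)
open import Function.Base using (_∘_; id)
open import Function.Bundles using (_⇔_; mk⇔; Equivalence)
open import Function.Definitions using (Injective)
open import Induction.WellFounded using (Acc; acc)
open import Relation.Binary.Definitions using (tri<; tri≈; tri>)
open import Relation.Binary.PropositionalEquality
  using (_≡_; _≢_; ≢-sym; refl; sym; trans; cong; cong₂; subst; subst₂; module ≡-Reasoning)
open import Relation.Nullary using (¬_; Dec; yes; no; ofʸ; ofⁿ)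
open import Relation.Nullary.Decidable using (_⊎-dec_; _×-dec_; ¬?; map′)

-- Walks and reachability

module _ {n : ℕ} (G : Graph n) where

  Step : Fin n → Fin n → Set
  Step u v = v ≡ u ⊎ Adj G u v

  step⇒adj : ∀ {u v} → v ≢ u → Step u v → Adj G u v
  step⇒adj v≢u (inj₁ v≡u) = ⊥-elim (v≢u v≡u)
  step⇒adj _   (inj₂ uv)  = uv

  Step-sym : ∀ {u v} → Step u v → Step v u
  Step-sym (inj₁ v≡u) = inj₁ (sym v≡u)
  Step-sym (inj₂ uv)  = inj₂ (symAdj G uv)

  data WalkIn (Q : Fin n → Set) : Fin n → Fin n → Set where
    end    : ∀ {u} → Q u → WalkIn Q u u
    _∷⟨_⟩_ : ∀ {u w v} → Q u → Adj G u w → WalkIn Q w v → WalkIn Q u v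

step? : ∀ {n} (G : Graph n) u v → Dec (Step G u v)
step? G u v = (v ≟ᶠ u) ⊎-dec adj? G u v

adj⇒≢ : ∀ {n} (G : Graph n) {u v} → Adj G u v → u ≢ v
adj⇒≢ G uv refl = irrefl G uv

module _ {n : ℕ} {G : Graph n} where

  head : ∀ {Q u v} → WalkIn G Q u v → Q u
  head (end qu)       = qu
  head (qu ∷⟨ _ ⟩ _) = qu

  first-step : ∀ {Q u v} → WalkIn G Q u v → u ≢ v → ∃[ w ] Q w × Adj G u w
  first-step (end _)          u≢u = ⊥-elim (u≢u refl)
  first-step (_ ∷⟨ uw ⟩ rest) _   = _ , head rest , uw

  walk-along : ∀ {Q} (g : ℕ → Fin n) → (∀ t → Adj G (g t) (g (suc t))) →
               ∀ d → (∀ {t} → t ≤ d → Q (g t)) → WalkIn G Q (g 0) (g d)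
  walk-along g edge zero    q = end (q z≤n)
  walk-along g edge (suc d) q =
    q z≤n ∷⟨ edge 0 ⟩ walk-along (λ t → g (suc t)) (λ t → edge (suc t)) d (λ t≤d → q (s≤s t≤d))

  reach⇒walk : ∀ {Q u v} → (∀ {x} → Q x) → Reach G u v → WalkIn G Q u v
  reach⇒walk q here        = end q
  reach⇒walk q (step uw r) = q ∷⟨ uw ⟩ reach⇒walk q r

  Reach-snoc : ∀ {u w v} → Reach G u w → Adj G w v → Reach G u v
  Reach-snoc here        wv = step wv here
  Reach-snoc (step uw r) wv = step uw (Reach-snoc r wv)

  Reach-sym : ∀ {u v} → Reach G u v → Reach G v u
  Reach-sym here        = here
  Reach-sym (step uw r) = Reach-snoc (Reach-sym r) (symAdj G uw)

  Reach-trans : ∀ {u w v} → Reach G u w → Reach G w v → Reach G u v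
  Reach-trans here        q = q
  Reach-trans (step uw r) q = step uw (Reach-trans r q)

  step⇒reach : ∀ {u v} → Step G u v → Reach G u v
  step⇒reach (inj₁ refl) = here
  step⇒reach (inj₂ uv)   = step uv here

  copWinsFrom⇒reach : ∀ {c r} → CopWinsFrom G c r → Reach G c r
  copWinsFrom⇒reach (caught refl)                 = here
  copWinsFrom⇒reach (move c' cc' (inj₁ refl))     = step⇒reach cc'
  copWinsFrom⇒reach (move c' cc' (inj₂ continue)) =
    Reach-trans (step⇒reach cc') (copWinsFrom⇒reach (continue _ (inj₁ refl)))

  copWin⇒connected : CopWin G → Connected G
  copWin⇒connected (c , wins) u v =
    Reach-trans (Reach-sym (copWinsFrom⇒reach (wins u))) (copWinsFrom⇒reach (wins v))

-- Outerplanar drawings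

-- For y distinct from a and b: does y lie strictly between a and b?
between : ℕ → ℕ → ℕ → Bool
between a b y = (a <ᵇ y) xor (b <ᵇ y)

between-true : ∀ {a b y} → a < b → y ≢ b → between a b y ≡ true → a < y × y < b
between-true {a} {b} {y} a<b y≢b eq with a <ᵇ y | <ᵇ-reflects-< a y | b <ᵇ y | <ᵇ-reflects-< b y
between-true a<b y≢b eq | true  | ofʸ a<y | false | ofⁿ b≮y = a<y , ≤∧≢⇒< (≮⇒≥ b≮y) y≢b
between-true a<b y≢b () | true  | _       | true  | _
between-true a<b y≢b eq | false | ofⁿ a≮y | true  | ofʸ b<y = ⊥-elim (a≮y (<-trans a<b b<y))
between-true a<b y≢b () | false | _       | false | _

between-false : ∀ {a b y} → a < b → y ≢ a → between a b y ≡ false → y < a ⊎ b < y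
between-false {a} {b} {y} a<b y≢a eq with a <ᵇ y | <ᵇ-reflects-< a y | b <ᵇ y | <ᵇ-reflects-< b y
between-false a<b y≢a () | true  | _       | false | _
between-false a<b y≢a eq | true  | _       | true  | ofʸ b<y = inj₂ b<y
between-false a<b y≢a eq | false | ofⁿ a≮y | true  | ofʸ b<y = ⊥-elim (a≮y (<-trans a<b b<y))
between-false a<b y≢a eq | false | ofⁿ a≮y | false | _       = inj₁ (≤∧≢⇒< (≮⇒≥ a≮y) y≢a)

<ᵇ-flip : ∀ {x y} → x ≢ y → (y <ᵇ x) ≡ not (x <ᵇ y)
<ᵇ-flip {x} {y} x≢y with x <ᵇ y | <ᵇ-reflects-< x y | y <ᵇ x | <ᵇ-reflects-< y x
... | true  | ofʸ x<y | true  | ofʸ y<x = ⊥-elim (<-asym x<y y<x)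
... | true  | _       | false | _       = refl
... | false | _       | true  | _       = refl
... | false | ofⁿ x≮y | false | ofⁿ y≮x = ⊥-elim (x≢y (≤-antisym (≮⇒≥ y≮x) (≮⇒≥ x≮y)))

-- Expanding each term, every comparison with a cancels, and each of the
-- three pairs among b, c, d contributes [x < y] xor [y < x] = true.
chord-parity : ∀ a b c d → b ≢ c → b ≢ d → c ≢ d →
  (between a b c xor between a b d) xor (between a c b xor between a c d)
    xor (between a d b xor between a d c) ≡ true
chord-parity a b c d b≢c b≢d c≢d
  rewrite <ᵇ-flip b≢c | <ᵇ-flip b≢d | <ᵇ-flip c≢d
  = parity (a <ᵇ b) (a <ᵇ c) (a <ᵇ d) (b <ᵇ c) (b <ᵇ d) (c <ᵇ d)
  where
    open xor-∧-Solver
    parity : ∀ ab ac ad bc bd cd →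
      ((ac xor bc) xor (ad xor bd)) xor ((ab xor not bc) xor (ad xor cd))
        xor ((ab xor not bd) xor (ac xor not cd)) ≡ true
    parity = solve 6 (λ ab ac ad bc bd cd →
      ((ac :+ bc) :+ (ad :+ bd)) :+ (((ab :+ (con true :+ bc)) :+ (ad :+ cd))
        :+ ((ab :+ (con true :+ bd)) :+ (ac :+ (con true :+ cd)))) := con true) refl

xor-true⇒some-≢ : ∀ {x y z w u v : Bool} → (x xor y) xor (z xor w) xor (u xor v) ≡ true →
                  x ≢ y ⊎ z ≢ w ⊎ u ≢ v
xor-true⇒some-≢ {x} {y} {z} {w} {u} {v} eq with x ≟ᵇ y | z ≟ᵇ w | u ≟ᵇ v
... | no x≢y   | _        | _        = inj₁ x≢y
... | yes _    | no z≢w   | _        = inj₂ (inj₁ z≢w)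
... | yes _    | yes _    | no u≢v   = inj₂ (inj₂ u≢v)
... | yes refl | yes refl | yes refl
      with trans (sym eq) (cong₂ _xor_ (xor-same x) (cong₂ _xor_ (xor-same z) (xor-same u)))
...   | ()

module ConvexDrawing {m : ℕ} (G : Graph m) (outer : Outerplanar G) where

  P : Fin m → ℕ
  P v = toℕ (proj₁ outer v)

  P-injective : ∀ {u v} → P u ≡ P v → u ≡ v
  P-injective eq = proj₁ (proj₂ outer) (toℕ-injective eq)

  P-≢ : ∀ {u v} → u ≢ v → P u ≢ P v
  P-≢ u≢v eq = u≢v (P-injective eq)

  noCrossing : ∀ {a b c d} → Adj G a b → Adj G c d → P a < P c → P c < P b → P b < P d → ⊥
  noCrossing ab cd a<c c<b b<d = proj₂ (proj₂ outer) _ _ _ _ ab cd (a<c , c<b , b<d)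

  Avoids : Fin m → Fin m → Fin m → Set
  Avoids u w y = y ≢ u × y ≢ w

  side : Fin m → Fin m → Fin m → Bool
  side u w y = between (P u) (P w) (P y)

  private
    inside-outside-cross : ∀ {u w y z} → Adj G u w → Adj G y z → P u < P y × P y < P w →
                           P z < P u ⊎ P w < P z → ⊥
    inside-outside-cross uw yz (u<y , y<w) (inj₁ z<u) = noCrossing (symAdj G yz) uw z<u u<y y<w
    inside-outside-cross uw yz (u<y , y<w) (inj₂ w<z) = noCrossing uw yz u<y y<w w<z

    edge-keeps-side< : ∀ {u w y z} → P u < P w → Adj G u w → Adj G y z →
                       Avoids u w y → Avoids u w z → side u w y ≡ side u w z
    edge-keeps-side< {u} {w} {y} {z} u<w uw yz (y≢u , y≢w) (z≢u , z≢w)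
      with side u w y in ey | side u w z in ez
    ... | true  | true  = refl
    ... | false | false = refl
    ... | true  | false = ⊥-elim (inside-outside-cross uw yz
                            (between-true u<w (P-≢ y≢w) ey) (between-false u<w (P-≢ z≢u) ez))
    ... | false | true  = ⊥-elim (inside-outside-cross uw (symAdj G yz)
                            (between-true u<w (P-≢ z≢w) ez) (between-false u<w (P-≢ y≢u) ey))

  edge-keeps-side : ∀ {u w y z} → Adj G u w → Adj G y z →
                    Avoids u w y → Avoids u w z → side u w y ≡ side u w z
  edge-keeps-side {u} {w} {y} {z} uw yz (y≢u , y≢w) (z≢u , z≢w) with <-cmp (P u) (P w)
  ... | tri< u<w _ _ = edge-keeps-side< u<w uw yz (y≢u , y≢w) (z≢u , z≢w)
  ... | tri≈ _ u≡w _ = ⊥-elim (adj⇒≢ G uw (P-injective u≡w))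
  ... | tri> _ _ w<u = begin
    side u w y  ≡⟨ xor-comm (P u <ᵇ P y) (P w <ᵇ P y) ⟩
    side w u y  ≡⟨ edge-keeps-side< w<u (symAdj G uw) yz (y≢w , y≢u) (z≢w , z≢u) ⟩
    side w u z  ≡⟨ xor-comm (P w <ᵇ P z) (P u <ᵇ P z) ⟩
    side u w z  ∎
    where open ≡-Reasoning

  walk-keeps-side : ∀ {u w y z} → Adj G u w → WalkIn G (Avoids u w) y z → side u w y ≡ side u w z
  walk-keeps-side uw (end _)            = refl
  walk-keeps-side uw (avoids ∷⟨ yz ⟩ p) = trans (edge-keeps-side uw yz avoids (head p)) (walk-keeps-side uw p)

  -- One of the chords cx, cp, cq separates the two remaining vertices, yet the
  -- walk and the edges xq, xp join them without meeting the chord.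
  ¬subdividedK4 : ∀ {c x p q} → Adj G c x → Adj G c p → Adj G c q → Adj G x p → Adj G x q →
                  p ≢ q → WalkIn G (Avoids c x) p q → ⊥
  ¬subdividedK4 {c} {x} {p} {q} cx cp cq xp xq p≢q walk
    with xor-true⇒some-≢ (chord-parity (P c) (P x) (P p) (P q)
                            (P-≢ (adj⇒≢ G xp)) (P-≢ (adj⇒≢ G xq)) (P-≢ p≢q))
  ... | inj₁ separated        = separated (walk-keeps-side cx walk)
  ... | inj₂ (inj₁ separated) = separated (edge-keeps-side cp xq
                                  (≢-sym (adj⇒≢ G cx) , adj⇒≢ G xp) (≢-sym (adj⇒≢ G cq) , ≢-sym p≢q))
  ... | inj₂ (inj₂ separated) = separated (edge-keeps-side cq xp
                                  (≢-sym (adj⇒≢ G cx) , adj⇒≢ G xq) (≢-sym (adj⇒≢ G cp) , p≢q))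

-- Induced cycles

-- Succ k i j unfolds to CyclicSucc k (toℕ i) (toℕ j); on ℕ its equations can
-- be matched on.
CyclicSucc : ℕ → ℕ → ℕ → Set
CyclicSucc k x y = suc x ≡ y ⊎ (suc x ≡ k × y ≡ 0)

CyclicSucc-functional : ∀ {k x y y'} → y < k → y' < k →
                        CyclicSucc k x y → CyclicSucc k x y' → y ≡ y'
CyclicSucc-functional _   _    (inj₁ refl)       (inj₁ refl)       = refl
CyclicSucc-functional y<k _    (inj₁ refl)       (inj₂ (refl , _)) = ⊥-elim (<-irrefl refl y<k)
CyclicSucc-functional _   y'<k (inj₂ (refl , _)) (inj₁ refl)       = ⊥-elim (<-irrefl refl y'<k)
CyclicSucc-functional _   _    (inj₂ (_ , refl)) (inj₂ (_ , refl)) = refl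

CyclicSucc-injective : ∀ {k x x' y} → CyclicSucc k x y → CyclicSucc k x' y → x ≡ x'
CyclicSucc-injective (inj₁ refl)       (inj₁ eq)        = suc-injective (sym eq)
CyclicSucc-injective (inj₁ refl)       (inj₂ (_ , ()))
CyclicSucc-injective (inj₂ (_ , refl)) (inj₁ ())
CyclicSucc-injective (inj₂ (eq , _))   (inj₂ (eq' , _)) = suc-injective (trans eq (sym eq'))

CyclicSucc-irrefl : ∀ {k x} → 2 ≤ k → ¬ CyclicSucc k x x
CyclicSucc-irrefl _             (inj₁ ())
CyclicSucc-irrefl (s≤s (s≤s _)) (inj₂ (() , refl))

CyclicSucc-asym : ∀ {k x y} → 3 ≤ k → CyclicSucc k x y → ¬ CyclicSucc k y x
CyclicSucc-asym _                   (inj₁ refl)          (inj₁ ())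
CyclicSucc-asym (s≤s (s≤s (s≤s _))) (inj₁ refl)          (inj₂ (refl , ()))
CyclicSucc-asym (s≤s (s≤s (s≤s _))) (inj₂ (refl , refl)) (inj₁ ())
CyclicSucc-asym (s≤s (s≤s _))       (inj₂ (refl , refl)) (inj₂ (() , _))

CyclicSucc-no3cycle : ∀ {k x y z} → 4 ≤ k → CyclicSucc k x y → CyclicSucc k y z → ¬ CyclicSucc k z x
CyclicSucc-no3cycle _ (inj₁ refl) (inj₁ refl) (inj₁ ())
CyclicSucc-no3cycle (s≤s (s≤s (s≤s (s≤s _)))) (inj₁ refl)          (inj₁ refl)          (inj₂ (refl , ()))
CyclicSucc-no3cycle (s≤s (s≤s (s≤s (s≤s _)))) (inj₁ refl)          (inj₂ (refl , refl)) (inj₁ ())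
CyclicSucc-no3cycle (s≤s (s≤s (s≤s (s≤s _)))) (inj₂ (refl , refl)) (inj₁ refl)          (inj₁ ())
CyclicSucc-no3cycle (s≤s (s≤s _))             (inj₂ (refl , refl)) (inj₂ (() , refl))   _

module CyclicIndex (k : ℕ) .{{_ : NonZero k}} where

  idx : ℕ → Fin k
  idx t = t mod k

  %≡⇒idx≡ : ∀ {t} {i : Fin k} → t % k ≡ toℕ i → idx t ≡ i
  %≡⇒idx≡ eq = toℕ-injective (trans (toℕ-fromℕ< _) eq)

  idx≡⇒%≡ : ∀ {t} {i : Fin k} → idx t ≡ i → t % k ≡ toℕ i
  idx≡⇒%≡ eq = trans (sym (toℕ-fromℕ< _)) (cong toℕ eq)

  idx-toℕ : ∀ (i : Fin k) → idx (toℕ i) ≡ i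
  idx-toℕ i = %≡⇒idx≡ (m<n⇒m%n≡m (toℕ<n i))

  idx-k+ : ∀ (i : Fin k) → idx (k + toℕ i) ≡ i
  idx-k+ i = %≡⇒idx≡ (begin
    (k + toℕ i) % k  ≡⟨ %-congˡ (+-comm k (toℕ i)) ⟩
    (toℕ i + k) % k  ≡⟨ [m+n]%n≡m%n (toℕ i) k ⟩
    toℕ i % k        ≡⟨ m<n⇒m%n≡m (toℕ<n i) ⟩
    toℕ i            ∎)
    where open ≡-Reasoning

  private
    suc-% : ∀ t → suc t % k ≡ suc (t % k) % k
    suc-% t = begin
      (1 + t) % k              ≡⟨ %-distribˡ-+ 1 t k ⟩
      (1 % k + t % k) % k      ≡⟨ cong (λ r → (1 % k + r) % k) (m%n%n≡m%n t k) ⟨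
      (1 % k + t % k % k) % k  ≡⟨ %-distribˡ-+ 1 (t % k) k ⟨
      (1 + t % k) % k          ∎
      where open ≡-Reasoning

    offset-bound : ∀ {d a} → suc d < k → d + suc a < a + k
    offset-bound {d} {a} 1+d<k = begin-strict
      d + suc a  ≡⟨ +-suc d a ⟩
      suc d + a  <⟨ +-monoˡ-< a 1+d<k ⟩
      k + a      ≡⟨ +-comm k a ⟩
      a + k      ∎
      where open ≤-Reasoning

  idx-succ : ∀ t → Succ k (idx t) (idx (suc t))
  idx-succ t rewrite toℕ-fromℕ< (m%n<n t k) | toℕ-fromℕ< (m%n<n (suc t) k)
    with suc (t % k) <? k
  ... | yes lt = inj₁ (sym (trans (suc-% t) (m<n⇒m%n≡m lt)))
  ... | no ¬lt = inj₂ (wraps , trans (suc-% t) (trans (%-congˡ wraps) (n%n≡0 k)))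
    where wraps = ≤-antisym (m%n<n t k) (≮⇒≥ ¬lt)

  idx-offset≢ : ∀ {d} (i : Fin k) → suc d < k → idx (d + suc (toℕ i)) ≢ i
  idx-offset≢ {d} i 1+d<k eq with d + suc (toℕ i) <? k
  ... | yes x<k = <⇒≢ (m≤n+m (suc (toℕ i)) d) (sym (trans (sym (m<n⇒m%n≡m x<k)) (idx≡⇒%≡ eq)))
  ... | no x≮k  = <⇒≢ x∸k<i (begin
      x ∸ k        ≡⟨ m<n⇒m%n≡m (<-trans x∸k<i (toℕ<n i)) ⟨
      (x ∸ k) % k  ≡⟨ m≤n⇒[n∸m]%m≡n%m (≮⇒≥ x≮k) ⟩
      x % k        ≡⟨ idx≡⇒%≡ eq ⟩
      toℕ i        ∎)
    where
      open ≡-Reasoning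
      x = d + suc (toℕ i)
      x∸k<i : x ∸ k < toℕ i
      x∸k<i = subst (x ∸ k <_) (m+n∸n≡m (toℕ i) k) (∸-monoˡ-< (offset-bound 1+d<k) (≮⇒≥ x≮k))

module InducedCycle {m : ℕ} (G : Graph m) {k : ℕ} (4≤k : 4 ≤ k) {f : Fin k → Fin m}
                    (cycle : IsInducedCycle G k f) where

  private
    3≤k : 3 ≤ k
    3≤k = ≤-trans (n≤1+n 3) 4≤k

    2≤k : 2 ≤ k
    2≤k = ≤-trans (n≤1+n 2) 3≤k

    instance
      k-nonZero : NonZero k
      k-nonZero = >-nonZero (≤-trans (s≤s z≤n) 4≤k)

  open CyclicIndex k

  f-injective : Injective _≡_ _≡_ f
  f-injective = proj₁ cycle

  adj⇔cycAdj : ∀ i j → Adj G (f i) (f j) ⇔ CycAdj k i j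
  adj⇔cycAdj = proj₂ cycle

  succ-functional : ∀ {i j j'} → Succ k i j → Succ k i j' → j ≡ j'
  succ-functional {j = j} {j'} s s' = toℕ-injective (CyclicSucc-functional (toℕ<n j) (toℕ<n j') s s')

  succ-injective : ∀ {i i' j} → Succ k i j → Succ k i' j → i ≡ i'
  succ-injective s s' = toℕ-injective (CyclicSucc-injective s s')

  next prev : Fin k → Fin k
  next i = idx (suc (toℕ i))
  prev i = idx (k ∸ 2 + suc (toℕ i))

  next-succ : ∀ i → Succ k i (next i)
  next-succ i = subst (λ j → Succ k j (next i)) (idx-toℕ i) (idx-succ (toℕ i))

  prev-succ : ∀ i → Succ k (prev i) i
  prev-succ i = subst (Succ k (prev i)) (trans (cong idx wraps) (idx-k+ i)) (idx-succ (k ∸ 2 + suc (toℕ i)))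
    where
      wraps : suc (k ∸ 2 + suc (toℕ i)) ≡ k + toℕ i
      wraps = trans (cong suc (+-suc (k ∸ 2) (toℕ i))) (cong (_+ toℕ i) (m+[n∸m]≡n 2≤k))

  succ⇒adj : ∀ {i j} → Succ k i j → Adj G (f i) (f j)
  succ⇒adj {i} {j} s = Equivalence.from (adj⇔cycAdj i j) (inj₁ s)

  adj-next : ∀ i → Adj G (f i) (f (next i))
  adj-next i = succ⇒adj (next-succ i)

  adj-prev : ∀ i → Adj G (f i) (f (prev i))
  adj-prev i = symAdj G (succ⇒adj (prev-succ i))

  adj⇒prev-or-next : ∀ {l i} → Adj G (f l) (f i) → l ≡ prev i ⊎ l ≡ next i
  adj⇒prev-or-next {l} {i} a with Equivalence.to (adj⇔cycAdj l i) a
  ... | inj₁ l→i = inj₁ (succ-injective l→i (prev-succ i))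
  ... | inj₂ i→l = inj₂ (succ-functional i→l (next-succ i))

  prev≢next : ∀ i → f (prev i) ≢ f (next i)
  prev≢next i eq = CyclicSucc-asym 3≤k (prev-succ i)
                     (subst (Succ k i) (sym (f-injective eq)) (next-succ i))

  prev≁next : ∀ i → ¬ Adj G (f (prev i)) (f (next i))
  prev≁next i a with Equivalence.to (adj⇔cycAdj (prev i) (next i)) a
  ... | inj₁ prev→next = CyclicSucc-irrefl 2≤k
                           (subst (Succ k i) (sym (succ-functional (prev-succ i) prev→next)) (next-succ i))
  ... | inj₂ next→prev = CyclicSucc-no3cycle 4≤k (prev-succ i) (next-succ i) next→prev

  ¬step-prev-next : ∀ i → ¬ Step G (f (prev i)) (f (next i))
  ¬step-prev-next i (inj₁ eq) = prev≢next i (sym eq)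
  ¬step-prev-next i (inj₂ a)  = prev≁next i a

  ¬step-next-prev : ∀ i → ¬ Step G (f (next i)) (f (prev i))
  ¬step-next-prev i (inj₁ eq) = prev≢next i eq
  ¬step-next-prev i (inj₂ a)  = prev≁next i (symAdj G a)

  around : ∀ {Q} i → (∀ {l} → l ≢ i → Q (f l)) → WalkIn G Q (f (next i)) (f (prev i))
  around i q = walk-along (λ t → f (idx (t + suc (toℕ i)))) (λ t → succ⇒adj (idx-succ (t + suc (toℕ i))))
                 (k ∸ 2) (λ t≤k∸2 → q (idx-offset≢ i (subst (_ ≤_) (m+[n∸m]≡n 2≤k) (s≤s (s≤s t≤k∸2)))))

module _ {m : ℕ} (G : Graph m) (e : ℕ → Fin m) (n : ℕ)
         (distinct : ∀ {p q} → p < q → q ≤ n → e p ≢ e q)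
         (edge : ∀ {p} → p < n → Adj G (e p) (e (suc p)))
         (closing : Adj G (e n) (e 0))
         (chordless : ∀ {p q} → suc p < q → q ≤ n → Adj G (e p) (e q) → p ≡ 0 × q ≡ n) where

  private
    succ⇒adj : ∀ {p q} → q ≤ n → CyclicSucc (suc n) p q → Adj G (e p) (e q)
    succ⇒adj q≤n (inj₁ refl)        = edge q≤n
    succ⇒adj q≤n (inj₂ (eq , refl)) = subst (λ z → Adj G (e z) (e 0)) (sym (suc-injective eq)) closing

    adj⇒succ : ∀ {p q} → p < q → q ≤ n → Adj G (e p) (e q) →
               CyclicSucc (suc n) p q ⊎ CyclicSucc (suc n) q p
    adj⇒succ p<q q≤n a with m≤n⇒m<n∨m≡n p<q
    ... | inj₂ 1+p≡q = inj₁ (inj₁ 1+p≡q)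
    ... | inj₁ 1+p<q = let p≡0 , q≡n = chordless 1+p<q q≤n a in inj₂ (inj₂ (cong suc q≡n , p≡0))

    bound : (i : Fin (suc n)) → toℕ i ≤ n
    bound i = ≤-pred (toℕ<n i)

  sequence⇒inducedCycle : IsInducedCycle G (suc n) (λ i → e (toℕ i))
  sequence⇒inducedCycle = injective , λ i j → mk⇔ (to i j) (from i j)
    where
      injective : Injective _≡_ _≡_ (λ i → e (toℕ i))
      injective {i} {j} eq with <-cmp (toℕ i) (toℕ j)
      ... | tri< i<j _ _ = ⊥-elim (distinct i<j (bound j) eq)
      ... | tri≈ _ i≡j _ = toℕ-injective i≡j
      ... | tri> _ _ j<i = ⊥-elim (distinct j<i (bound i) (sym eq))

      to : ∀ i j → Adj G (e (toℕ i)) (e (toℕ j)) → CycAdj (suc n) i j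
      to i j a with <-cmp (toℕ i) (toℕ j)
      ... | tri< i<j _ _ = adj⇒succ i<j (bound j) a
      ... | tri≈ _ i≡j _ = ⊥-elim (adj⇒≢ G a (cong e i≡j))
      ... | tri> _ _ j<i = swap (adj⇒succ j<i (bound i) (symAdj G a))

      from : ∀ i j → CycAdj (suc n) i j → Adj G (e (toℕ i)) (e (toℕ j))
      from i j (inj₁ i→j) = succ⇒adj (bound j) i→j
      from i j (inj₂ j→i) = symAdj G (succ⇒adj (bound i) j→i)

module Robber {m : ℕ} (G : Graph m) (outer : Outerplanar G) {k : ℕ} (4≤k : 4 ≤ k)
              {f : Fin k → Fin m} (cycle : IsInducedCycle G k f) where

  open ConvexDrawing G outer using (¬subdividedK4)
  open InducedCycle G 4≤k cycle

  cannot-guard-both : ∀ {c i} → Adj G c (f i) → Step G c (f (prev i)) → Step G c (f (next i)) → ⊥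
  cannot-guard-both {c} {i} c~fi onPrev onNext with any? (λ l → f l ≟ᶠ c)
  ... | yes (l , refl) with adj⇒prev-or-next c~fi
  ...   | inj₁ refl = ¬step-prev-next i onNext
  ...   | inj₂ refl = ¬step-next-prev i onPrev
  cannot-guard-both {c} {i} c~fi onPrev onNext | no offCycle =
    ¬subdividedK4 c~fi (step⇒adj G off onNext) (step⇒adj G off onPrev) (adj-next i) (adj-prev i)
      (≢-sym (prev≢next i)) (around i (λ l≢i → off , l≢i ∘ f-injective))
    where
      off : ∀ {l} → f l ≢ c
      off eq = offCycle (_ , eq)

  robber-reply : ∀ c i → c ≢ f i → ∃[ j ] Step G (f i) (f j) × ¬ Step G c (f j)
  robber-reply c i c≢fi with adj? G c (f i)
  ... | no c≁fi = i , inj₁ refl , [ c≢fi ∘ sym , c≁fi ]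
  ... | yes c~fi with step? G c (f (prev i)) | step? G c (f (next i))
  ...   | no free     | _          = prev i , inj₂ (adj-prev i) , free
  ...   | yes _       | no free    = next i , inj₂ (adj-next i) , free
  ...   | yes onPrev  | yes onNext = ⊥-elim (cannot-guard-both c~fi onPrev onNext)

  robber-start : ∀ c → ∃[ i ] ¬ Step G c (f i)
  robber-start c with any? (λ l → f l ≟ᶠ c)
  ... | yes (l , refl) = let j , _ , free = robber-reply c (next l) (adj⇒≢ G (adj-next l)) in j , free
  ... | no offCycle    = let j , _ , free = robber-reply c i₀ (λ eq → offCycle (i₀ , sym eq)) in j , free
    where i₀ = fromℕ< (≤-trans (s≤s z≤n) 4≤k)

  escape : ∀ {c i} → ¬ Step G c (f i) → ¬ CopWinsFrom G c (f i)
  escape free (caught c≡fi)              = free (inj₁ (sym c≡fi))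
  escape free (move c' cc' (inj₁ c'≡fi)) = free (subst (Step G _) c'≡fi cc')
  escape {i = i} free (move c' cc' (inj₂ continue)) with c' ≟ᶠ f i
  ... | yes c'≡fi = free (subst (Step G _) c'≡fi cc')
  ... | no c'≢fi  = let j , reply , free' = robber-reply c' i c'≢fi in escape free' (continue (f j) reply)

  ¬copWin : ¬ CopWin G
  ¬copWin (c , wins) = let i , free = robber-start c in escape free (wins (f i))

-- Dismantling

x∉p-x : ∀ {n} {p : Subset n} (x : Fin n) → x ∉ p - x
x∉p-x {p = inside  ∷ _} fzero    ()
x∉p-x {p = outside ∷ _} fzero    ()
x∉p-x {p = _       ∷ _} (fsuc x) (there x∈p-x) = x∉p-x x x∈p-x

module Dismantling {m : ℕ} (G : Graph m) where

  data CopWinsIn (S : Subset m) : Fin m → Fin m → Set where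
    caught : ∀ {c r} → c ≡ r → CopWinsIn S c r
    move   : ∀ {c r} c' → c' ∈ S → Step G c c' →
             (c' ≡ r ⊎ (∀ r' → r' ∈ S → Step G r r' → CopWinsIn S c' r')) → CopWinsIn S c r

  CopWinIn : Subset m → Set
  CopWinIn S = ∃[ c ] c ∈ S × (∀ {r} → r ∈ S → CopWinsIn S c r)

  copWinsIn-⊤ : ∀ {c r} → CopWinsIn ⊤ c r → CopWinsFrom G c r
  copWinsIn-⊤ (caught c≡r)                    = caught c≡r
  copWinsIn-⊤ (move c' _ cc' (inj₁ c'≡r))     = move c' cc' (inj₁ c'≡r)
  copWinsIn-⊤ (move c' _ cc' (inj₂ continue)) =
    move c' cc' (inj₂ (λ r' rr' → copWinsIn-⊤ (continue r' ∈⊤ rr')))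

  ConnectedIn : Subset m → Set
  ConnectedIn S = ∀ {x y} → x ∈ S → y ∈ S → WalkIn G (_∈ S) x y

  NoIsolated : Subset m → Set
  NoIsolated S = ∀ {x} → x ∈ S → ∃[ y ] y ∈ S × Adj G x y

  record Dominated (S : Subset m) (v u : Fin m) : Set where
    field
      v∈S    : v ∈ S
      u∈S    : u ∈ S
      u≢v    : u ≢ v
      covers : ∀ {w} → w ∈ S → Step G v w → Step G u w

  HasDominatedVertex : Subset m → Set
  HasDominatedVertex S = ∃[ v ] ∃[ u ] Dominated S v u

  module Retract {S v u} (dom : Dominated S v u) where
    open Dominated dom

    u∈S-v : u ∈ S - v
    u∈S-v = x∈p∧x≢y⇒x∈p-y u∈S u≢v

    S-v⊆S : ∀ {x} → x ∈ S - v → x ∈ S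
    S-v⊆S = p─q⊆p S ⁅ v ⁆

    u~v : Adj G u v
    u~v = step⇒adj G (≢-sym u≢v) (covers v∈S (inj₁ refl))

    shadow : Fin m → Fin m
    shadow r with r ≟ᶠ v
    ... | yes _ = u
    ... | no  _ = r

    shadow-∈ : ∀ {r} → r ∈ S → shadow r ∈ S - v
    shadow-∈ {r} r∈S with r ≟ᶠ v
    ... | yes _  = u∈S-v
    ... | no r≢v = x∈p∧x≢y⇒x∈p-y r∈S r≢v

    shadow-id : ∀ {r} → r ∈ S - v → shadow r ≡ r
    shadow-id {r} r∈S-v with r ≟ᶠ v
    ... | yes refl = ⊥-elim (x∉p-x v r∈S-v)
    ... | no _     = refl

    shadow-step : ∀ {r r'} → r ∈ S → r' ∈ S → Step G r r' → Step G (shadow r) (shadow r')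
    shadow-step {r} {r'} r∈S r'∈S rr' with r ≟ᶠ v | r' ≟ᶠ v
    ... | yes _    | yes _    = inj₁ refl
    ... | yes refl | no _     = covers r'∈S rr'
    ... | no r≢v   | yes refl = Step-sym G (covers r∈S (inj₂ (symAdj G (step⇒adj G (≢-sym r≢v) rr'))))
    ... | no _     | no _     = rr'

    shadow-walk : ∀ {x y} → WalkIn G (_∈ S) x y → WalkIn G (_∈ S - v) (shadow x) (shadow y)
    shadow-walk (end x∈S) = end (shadow-∈ x∈S)
    shadow-walk (x∈S ∷⟨ xw ⟩ p) with shadow-step x∈S (head p) (inj₂ xw)
    ... | inj₁ same = subst (λ z → WalkIn G (_∈ S - v) z _) same (shadow-walk p)
    ... | inj₂ a    = shadow-∈ x∈S ∷⟨ a ⟩ shadow-walk p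

    connected-minus : ConnectedIn S → ConnectedIn (S - v)
    connected-minus conn x∈ y∈ =
      subst₂ (WalkIn G (_∈ S - v)) (shadow-id x∈) (shadow-id y∈) (shadow-walk (conn (S-v⊆S x∈) (S-v⊆S y∈)))

    lift : ∀ {c s} → CopWinsIn (S - v) c s → ∀ {r} → r ∈ S → shadow r ≡ s → CopWinsIn S c r
    lift (caught c≡s) {r} r∈S sr≡s with r ≟ᶠ v
    ... | yes refl = move v v∈S (inj₂ (subst (λ z → Adj G z v) (trans sr≡s (sym c≡s)) u~v)) (inj₁ refl)
    ... | no _     = caught (trans c≡s (sym sr≡s))
    lift (move c' c'∈ cc' (inj₁ c'≡s)) {r} r∈S sr≡s with r ≟ᶠ v
    ... | yes refl = move c' (S-v⊆S c'∈) cc' (inj₂ finish)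
      where
        -- The cop has reached u, and the robber on v cannot leave N[u].
        finish : ∀ r' → r' ∈ S → Step G v r' → CopWinsIn S c' r'
        finish r' r'∈S vr' with covers r'∈S vr'
        ... | inj₁ r'≡u = caught (trans c'≡s (trans (sym sr≡s) (sym r'≡u)))
        ... | inj₂ u~r' =
          move r' r'∈S (inj₂ (subst (λ z → Adj G z r') (trans sr≡s (sym c'≡s)) u~r')) (inj₁ refl)
    ... | no _     = move c' (S-v⊆S c'∈) cc' (inj₁ (trans c'≡s (sym sr≡s)))
    lift (move c' c'∈ cc' (inj₂ continue)) r∈S refl =
      move c' (S-v⊆S c'∈) cc' (inj₂ λ r' r'∈S rr' →
        lift (continue (shadow r') (shadow-∈ r'∈S) (shadow-step r∈S r'∈S rr')) r'∈S refl)

    lift-win : CopWinIn (S - v) → CopWinIn S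
    lift-win (c , c∈ , wins) = c , S-v⊆S c∈ , λ r∈S → lift (wins (shadow-∈ r∈S)) r∈S refl

  singleton-or-noIsolated : ∀ {S x} → x ∈ S → ConnectedIn S → (∀ {r} → r ∈ S → r ≡ x) ⊎ NoIsolated S
  singleton-or-noIsolated {S} {x} x∈S conn with any? (λ y → (y ∈? S) ×-dec ¬? (y ≟ᶠ x))
  ... | yes (y , y∈S , y≢x) = inj₂ noIsolated
    where
      noIsolated : NoIsolated S
      noIsolated {z} z∈S with z ≟ᶠ x
      ... | yes refl = first-step (conn z∈S y∈S) (≢-sym y≢x)
      ... | no z≢x   = first-step (conn z∈S x∈S) z≢x
  ... | no single = inj₁ only
    where
      only : ∀ {r} → r ∈ S → r ≡ x
      only {r} r∈S with r ≟ᶠ x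
      ... | yes r≡x = r≡x
      ... | no r≢x  = ⊥-elim (single (r , r∈S , r≢x))

  module _ (dominated : ∀ {S x} → x ∈ S → NoIsolated S → HasDominatedVertex S) where

    copWinIn : ∀ {S x} → x ∈ S → ConnectedIn S → Acc _<_ ∣ S ∣ → CopWinIn S
    copWinIn {S} {x} x∈S conn (acc smaller) with singleton-or-noIsolated x∈S conn
    ... | inj₁ only       = x , x∈S , λ r∈S → caught (sym (only r∈S))
    ... | inj₂ noIsolated with dominated x∈S noIsolated
    ...   | v , u , dom = lift-win (copWinIn u∈S-v (connected-minus conn) (smaller (x∈p⇒∣p-x∣<∣p∣ v∈S)))
      where open Retract dom
            open Dominated dom

    connected⇒copWin : Fin m → Connected G → CopWin G
    connected⇒copWin x conn =
      let c , _ , wins = copWinIn (∈⊤ {x = x}) (λ _ _ → reach⇒walk ∈⊤ (conn _ _)) (<-wellFounded _)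
      in c , λ r → copWinsIn-⊤ (wins ∈⊤)

-- Dominated vertices of outerplanar chordal graphs

module _ {A : Set} {Q : A → Set} (μ : A → ℕ) (smaller? : ∀ x → Dec (∃[ z ] Q z × μ z < μ x)) where

  minimiser : ∀ {x} → Q x → ∃[ y ] Q y × (∀ {z} → Q z → μ y ≤ μ z)
  minimiser {x} qx = descend qx (<-wellFounded (μ x))
    where
      descend : ∀ {x} → Q x → Acc _<_ (μ x) → ∃[ y ] Q y × (∀ {z} → Q z → μ y ≤ μ z)
      descend {x} qx (acc smaller) with smaller? x
      ... | yes (z , qz , z<x) = descend qz (smaller z<x)
      ... | no none            = x , qx , λ qz → ≮⇒≥ (λ z<x → none (_ , qz , z<x))

module OuterplanarChordal {m : ℕ} (G : Graph m) (outer : Outerplanar G) (chordal : Chordal G)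
                          {S : Subset m} (noIsolated : Dismantling.NoIsolated G S) where

  open ConvexDrawing G outer
  open Dismantling G

  NothingBetween : Fin m → Fin m → Set
  NothingBetween y z = ∀ {t} → t ∈ S → P y < P t → P t < P z → ⊥

  Covers : Fin m → Fin m → Fin m → Set
  Covers a b x = a ∈ S × b ∈ S × x ∈ S × Adj G a b × P a < P x × P x < P b

  covers? : ∀ a b x → Dec (Covers a b x)
  covers? a b x =
    (a ∈? S) ×-dec (b ∈? S) ×-dec (x ∈? S) ×-dec adj? G a b ×-dec (P a <? P x) ×-dec (P x <? P b)

  dominated-by : ∀ {v u} → v ∈ S → u ∈ S → Adj G v u →
                 (∀ {w} → w ∈ S → Adj G v w → Step G u w) → Dominated S v u
  dominated-by {v} {u} v∈S u∈S vu neighbours =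
    record { v∈S = v∈S ; u∈S = u∈S ; u≢v = ≢-sym (adj⇒≢ G vu) ; covers = closed }
    where
      closed : ∀ {w} → w ∈ S → Step G v w → Step G u w
      closed _   (inj₁ refl) = inj₂ (symAdj G vu)
      closed w∈S (inj₂ vw)   = neighbours w∈S vw

  pendant-dominated : ∀ {v} → v ∈ S → (∀ {w w'} → w ∈ S → w' ∈ S → Adj G v w → Adj G v w' → w ≡ w') →
                      HasDominatedVertex S
  pendant-dominated v∈S unique =
    let u , u∈S , vu = noIsolated v∈S
    in _ , u , dominated-by v∈S u∈S vu (λ w∈S vw → inj₁ (unique w∈S u∈S vw vu))

  successor-unique : ∀ {x w z} → w ∈ S → z ∈ S →
                     P x < P w × NothingBetween x w → P x < P z × NothingBetween x z → w ≡ z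
  successor-unique {w = w} {z} w∈S z∈S (x<w , empty-w) (x<z , empty-z) with <-cmp (P w) (P z)
  ... | tri< w<z _ _ = ⊥-elim (empty-z w∈S x<w w<z)
  ... | tri≈ _ w≡z _ = P-injective w≡z
  ... | tri> _ _ z<w = ⊥-elim (empty-w z∈S x<z z<w)

  predecessor-unique : ∀ {x w z} → w ∈ S → z ∈ S →
                       P w < P x × NothingBetween w x → P z < P x × NothingBetween z x → w ≡ z
  predecessor-unique {w = w} {z} w∈S z∈S (w<x , empty-w) (z<x , empty-z) with <-cmp (P w) (P z)
  ... | tri< w<z _ _ = ⊥-elim (empty-w z∈S w<z z<x)
  ... | tri≈ _ w≡z _ = P-injective w≡z
  ... | tri> _ _ z<w = ⊥-elim (empty-z w∈S z<w w<x)

  leftmost-pendant : ∀ {x} → x ∈ S → (∀ {a b y} → ¬ Covers a b y) → HasDominatedVertex S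
  leftmost-pendant x∈S uncovered =
    let s , s∈S , leftmost = minimiser {Q = _∈ S} P (λ y → any? (λ z → (z ∈? S) ×-dec (P z <? P y))) x∈S
    in pendant-dominated s∈S (unique s∈S leftmost)
    where
      right-of : ∀ {s z} → (∀ {z} → z ∈ S → P s ≤ P z) → z ∈ S → Adj G s z → P s < P z
      right-of leftmost z∈S sz = ≤∧≢⇒< (leftmost z∈S) (P-≢ (adj⇒≢ G sz))

      unique : ∀ {s} → s ∈ S → (∀ {z} → z ∈ S → P s ≤ P z) →
               ∀ {w w'} → w ∈ S → w' ∈ S → Adj G s w → Adj G s w' → w ≡ w'
      unique s∈S leftmost {w} {w'} w∈S w'∈S sw sw' with <-cmp (P w) (P w')
      ... | tri< w<w' _ _ = ⊥-elim (uncovered (s∈S , w'∈S , w∈S , sw' , right-of leftmost w∈S sw , w<w'))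
      ... | tri≈ _ w≡w' _ = P-injective w≡w'
      ... | tri> _ _ w'<w = ⊥-elim (uncovered (s∈S , w∈S , w'∈S , sw , right-of leftmost w'∈S sw' , w'<w))

  module MinimalCover {a b x} (a∈S : a ∈ S) (b∈S : b ∈ S) (x∈S : x ∈ S) (a~b : Adj G a b)
                      (a<x : P a < P x) (x<b : P x < P b)
                      (minimal : ∀ {c d y} → Covers c d y → P b ∸ P a ≤ P d ∸ P c) where

    private
      a<b : P a < P b
      a<b = <-trans a<x x<b

    nested-cover⇒ab : ∀ {c d y} → Covers c d y → P a ≤ P c → P d ≤ P b → P c ≡ P a × P d ≡ P b
    nested-cover⇒ab {c} {d} cov@(_ , _ , _ , _ , c<y , y<d) a≤c d≤b = left , right
      where
        c≤d = <⇒≤ (<-trans c<y y<d)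
        c≤b = ≤-trans c≤d d≤b

        left : P c ≡ P a
        left with m≤n⇒m<n∨m≡n a≤c
        ... | inj₂ a≡c = sym a≡c
        ... | inj₁ a<c = ⊥-elim (<⇒≱ (≤-<-trans (∸-monoˡ-≤ (P c) d≤b) (∸-monoʳ-< a<c c≤b)) (minimal cov))

        right : P d ≡ P b
        right with m≤n⇒m<n∨m≡n d≤b
        ... | inj₂ d≡b = d≡b
        ... | inj₁ d<b = ⊥-elim (<⇒≱ (<-≤-trans (∸-monoˡ-< d<b c≤d) (∸-monoʳ-≤ (P b) a≤c)) (minimal cov))

    Inner : Fin m → Set
    Inner y = y ∈ S × P a < P y × P y < P b

    inner-neighbour : ∀ {y w} → Inner y → w ∈ S → Adj G y w →
                      (P y < P w × NothingBetween y w) ⊎ (P w < P y × NothingBetween w y)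
    inner-neighbour {y} {w} (y∈S , a<y , y<b) w∈S yw with <-cmp (P y) (P w)
    ... | tri< y<w _ _ = inj₁ (y<w , λ t∈S y<t t<w →
      <⇒≢ a<y (sym (proj₁ (nested-cover⇒ab (y∈S , w∈S , t∈S , yw , y<t , t<w) (<⇒≤ a<y) w≤b))))
      where w≤b = ≮⇒≥ (λ b<w → noCrossing a~b yw a<y y<b b<w)
    ... | tri≈ _ y≡w _ = ⊥-elim (adj⇒≢ G yw (P-injective y≡w))
    ... | tri> _ _ w<y = inj₂ (w<y , λ t∈S w<t t<y →
      <⇒≢ y<b (proj₂ (nested-cover⇒ab (w∈S , y∈S , t∈S , symAdj G yw , w<t , t<y) a≤w (<⇒≤ y<b))))
      where a≤w = ≮⇒≥ (λ w<a → noCrossing (symAdj G yw) a~b w<a a<y y<b)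

    Candidate : Fin m → Fin m → Set
    Candidate y z = z ∈ S × (P y < P z ⊎ z ≡ b) × P z ≤ P b

    -- The disjunct z ≡ b makes b a candidate for every y, so next is total,
    -- with next b = b.
    next-spec : ∀ y → ∃[ z ] Candidate y z × (∀ {z'} → Candidate y z' → P z ≤ P z')
    next-spec y = minimiser P smaller (b∈S , inj₂ refl , ≤-refl)
      where
        smaller : ∀ z → Dec (∃[ z' ] Candidate y z' × P z' < P z)
        smaller z = any? λ z' →
          ((z' ∈? S) ×-dec ((P y <? P z') ⊎-dec (z' ≟ᶠ b)) ×-dec (P z' ≤? P b)) ×-dec (P z' <? P z)

    next : Fin m → Fin m
    next y = proj₁ (next-spec y)

    next-candidate : ∀ y → Candidate y (next y)
    next-candidate y = proj₁ (proj₂ (next-spec y))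

    next-least : ∀ {y z} → z ∈ S → P y < P z → P z ≤ P b → P (next y) ≤ P z
    next-least {y} z∈S y<z z≤b = proj₂ (proj₂ (next-spec y)) (z∈S , inj₁ y<z , z≤b)

    next-b : next b ≡ b
    next-b with next-candidate b
    ... | _ , inj₁ b<next , next≤b = ⊥-elim (<⇒≱ b<next next≤b)
    ... | _ , inj₂ next≡b , _      = next≡b

    next-successor : ∀ {y} → P y < P b → P y < P (next y) × NothingBetween y (next y)
    next-successor {y} y<b = y<next , λ t∈S y<t t<next →
      <⇒≱ t<next (next-least t∈S y<t (<⇒≤ (<-≤-trans t<next (proj₂ (proj₂ (next-candidate y))))))
      where
        y<next : P y < P (next y)
        y<next with proj₁ (proj₂ (next-candidate y))
        ... | inj₁ y<next = y<next
        ... | inj₂ next≡b = subst (λ z → P y < P z) (sym next≡b) y<b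

    chain : ℕ → Fin m
    chain zero    = a
    chain (suc i) = next (chain i)

    Below : Fin m → Set
    Below y = P y < P b

    chain-∈ : ∀ i → chain i ∈ S
    chain-∈ zero    = a∈S
    chain-∈ (suc i) = proj₁ (next-candidate (chain i))

    chain-≤b : ∀ i → P (chain i) ≤ P b
    chain-≤b zero    = <⇒≤ a<b
    chain-≤b (suc i) = proj₂ (proj₂ (next-candidate (chain i)))

    chain-successor : ∀ i → Below (chain i) →
                      P (chain i) < P (chain (suc i)) × NothingBetween (chain i) (chain (suc i))
    chain-successor i = next-successor

    chain-below-pred : ∀ i → Below (chain (suc i)) → Below (chain i)
    chain-below-pred i below = ≤∧≢⇒< (chain-≤b i) λ chain-i≡b →
      <-irrefl (cong P (trans (cong next (P-injective chain-i≡b)) next-b)) below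

    chain-below : ∀ {p q} → p ≤ q → Below (chain q) → Below (chain p)
    chain-below {p} {q} p≤q below with m≤n⇒m<n∨m≡n p≤q
    ... | inj₂ refl = below
    ... | inj₁ p<q with q
    ...   | suc q' = chain-below (≤-pred p<q) (chain-below-pred q' below)

    chain-increasing : ∀ {p q} → p ≤ q → Below (chain q) → P (chain p) < P (chain (suc q))
    chain-increasing {p} {q} p≤q below with m≤n⇒m<n∨m≡n p≤q
    ... | inj₂ refl = proj₁ (chain-successor q below)
    ... | inj₁ p<q with q
    ...   | suc q' = <-trans (chain-increasing (≤-pred p<q) (chain-below-pred q' below))
                             (proj₁ (chain-successor (suc q') below))

    chain-neighbour : ∀ i {w} → Below (chain (suc i)) → w ∈ S → Adj G (chain (suc i)) w →
                      w ≡ chain i ⊎ w ≡ chain (suc (suc i))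
    chain-neighbour i below w∈S a =
      [ (λ right → inj₂ (successor-unique w∈S (chain-∈ (suc (suc i))) right
                                          (chain-successor (suc i) below)))
      , (λ left → inj₁ (predecessor-unique w∈S (chain-∈ i) left
                                           (chain-successor i (chain-below-pred i below))))
      ] (inner-neighbour inner w∈S a)
      where inner = chain-∈ (suc i) , chain-increasing {q = i} z≤n (chain-below-pred i below) , below

    PathUpTo : ℕ → Set
    PathUpTo i = ∀ {t} → t ≤ i → Adj G (chain t) (chain (suc t))

    path-extend : ∀ {i} → PathUpTo i → Adj G (chain (suc i)) (chain (suc (suc i))) → PathUpTo (suc i)
    path-extend path last {t} t≤1+i with m≤n⇒m<n∨m≡n t≤1+i
    ... | inj₁ t<1+i = path (≤-pred t<1+i)
    ... | inj₂ refl  = last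

    induced-cycle : ∀ i → Below (chain (suc i)) → PathUpTo (suc i) → chain (suc (suc i)) ≡ b →
                    IsInducedCycle G (suc (suc (suc i))) (λ j → chain (toℕ j))
    induced-cycle i below path reached =
      sequence⇒inducedCycle G chain n distinct (λ p<n → path (≤-pred p<n)) closing chordless
      where
        n = suc (suc i)

        increasing : ∀ {p q} → p < q → q ≤ n → P (chain p) < P (chain q)
        increasing {q = suc q} (s≤s p≤q) (s≤s q≤1+i) = chain-increasing p≤q (chain-below q≤1+i below)

        distinct : ∀ {p q} → p < q → q ≤ n → chain p ≢ chain q
        distinct p<q q≤n eq = <⇒≢ (increasing p<q q≤n) (cong P eq)

        closing : Adj G (chain n) (chain 0)
        closing = subst (λ z → Adj G z a) (sym reached) (symAdj G a~b)

        a≤chain : ∀ {p} → p ≤ n → P a ≤ P (chain p)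
        a≤chain {zero}  _   = ≤-refl
        a≤chain {suc p} p≤n = <⇒≤ (increasing (s≤s z≤n) p≤n)

        starts-at-a : ∀ {p} → p ≤ n → P (chain p) ≡ P a → p ≡ 0
        starts-at-a {zero}  _   _  = refl
        starts-at-a {suc p} p≤n eq = ⊥-elim (<⇒≢ (increasing (s≤s z≤n) p≤n) (sym eq))

        ends-at-b : ∀ {q} → q ≤ n → P (chain q) ≡ P b → q ≡ n
        ends-at-b {q} q≤n eq with m≤n⇒m<n∨m≡n q≤n
        ... | inj₁ q<n = ⊥-elim (<⇒≢ (subst (λ z → P (chain q) < P z) reached (increasing q<n ≤-refl)) eq)
        ... | inj₂ q≡n = q≡n

        chordless : ∀ {p q} → suc p < q → q ≤ n → Adj G (chain p) (chain q) → p ≡ 0 × q ≡ n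
        chordless {p} {q} 1+p<q q≤n pq = starts-at-a p≤n (proj₁ ends) , ends-at-b q≤n (proj₂ ends)
          where
            1+p≤n = <⇒≤ (<-≤-trans 1+p<q q≤n)
            p≤n   = ≤-trans (n≤1+n p) 1+p≤n
            ends  = nested-cover⇒ab (chain-∈ p , chain-∈ q , chain-∈ (suc p) , pq ,
                                     increasing (n<1+n p) 1+p≤n , increasing 1+p<q q≤n)
                                    (a≤chain p≤n) (chain-≤b q)

    chain-closes : ∀ i → Below (chain (suc i)) → PathUpTo (suc i) → chain (suc (suc i)) ≡ b →
                   HasDominatedVertex S
    chain-closes zero below path reached =
      chain 1 , a , dominated-by (chain-∈ 1) a∈S (symAdj G (path z≤n)) to-a-or-b
      where
        to-a-or-b : ∀ {w} → w ∈ S → Adj G (chain 1) w → Step G a w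
        to-a-or-b w∈S 1w = [ inj₁ , (λ w≡2 → inj₂ (subst (Adj G a) (sym (trans w≡2 reached)) a~b)) ]
                             (chain-neighbour 0 below w∈S 1w)
    chain-closes (suc i) below path reached =
      ⊥-elim (chordal (4 + i) (s≤s (s≤s (s≤s (s≤s z≤n)))) (λ j → chain (toℕ j))
                      (induced-cycle (suc i) below path reached))

    follow-chain : ∀ i → Below (chain (suc i)) → PathUpTo i → Acc _<_ (P b ∸ P (chain (suc i))) →
                   HasDominatedVertex S
    follow-chain i below path (acc rec) with adj? G (chain (suc i)) (chain (suc (suc i)))
    ... | no ¬forward =
      chain (suc i) , chain i , dominated-by (chain-∈ (suc i)) (chain-∈ i) (symAdj G (path ≤-refl)) backward
      where
        backward : ∀ {w} → w ∈ S → Adj G (chain (suc i)) w → Step G (chain i) w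
        backward w∈S iw = [ inj₁ , (λ w≡next → ⊥-elim (¬forward (subst (Adj G (chain (suc i))) w≡next iw))) ]
                            (chain-neighbour i below w∈S iw)
    ... | yes forward with P (chain (suc (suc i))) <? P b
    ...   | yes below' = follow-chain (suc i) below' (path-extend path forward)
                           (rec (∸-monoʳ-< (proj₁ (chain-successor (suc i) below)) (<⇒≤ below')))
    ...   | no ¬below' = chain-closes i below (path-extend path forward)
                           (P-injective (≤-antisym (chain-≤b (suc (suc i))) (≮⇒≥ ¬below')))

    private
      below₁ : Below (chain 1)
      below₁ = ≤-<-trans (next-least x∈S a<x (<⇒≤ x<b)) x<b

    dominated-vertex : HasDominatedVertex S
    dominated-vertex with adj? G a (chain 1)
    ... | yes a~1 = follow-chain 0 below₁ first (<-wellFounded _)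
      where
        first : PathUpTo 0
        first z≤n = a~1
    ... | no a≁1 =
      pendant-dominated (chain-∈ 1) (λ w∈S w'∈S 1w 1w' → trans (forward w∈S 1w) (sym (forward w'∈S 1w')))
      where
        forward : ∀ {w} → w ∈ S → Adj G (chain 1) w → w ≡ chain 2
        forward w∈S 1w = [ (λ w≡a → ⊥-elim (a≁1 (symAdj G (subst (Adj G (chain 1)) w≡a 1w)))) , id ]
                           (chain-neighbour 0 below₁ w∈S 1w)

  CoversTriple : Fin m × Fin m × Fin m → Set
  CoversTriple (a , b , x) = Covers a b x

  width : Fin m × Fin m × Fin m → ℕ
  width (a , b , _) = P b ∸ P a

  narrower? : ∀ t → Dec (∃[ t' ] CoversTriple t' × width t' < width t)
  narrower? t = map′ (λ (c , d , y , cov , narrower) → (c , d , y) , cov , narrower)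
                     (λ ((c , d , y) , cov , narrower) → c , d , y , cov , narrower)
                     (any? λ c → any? λ d → any? λ y → covers? c d y ×-dec (P d ∸ P c <? width t))

  dominated-vertex : ∀ {x} → x ∈ S → HasDominatedVertex S
  dominated-vertex x∈S with any? (λ a → any? (λ b → any? (λ y → covers? a b y)))
  ... | no uncovered = leftmost-pendant x∈S (λ cov → uncovered (_ , _ , _ , cov))
  ... | yes (a , b , y , cover) =
    let _ , (a∈S , b∈S , x∈S , a~b , a<x , x<b) , minimal =
          minimiser {Q = CoversTriple} width narrower? {a , b , y} cover
    in MinimalCover.dominated-vertex a∈S b∈S x∈S a~b a<x x<b (λ {c} {d} {z} → minimal {c , d , z})

theorem3p9 : (n : ℕ) (G : Graph (suc n)) → Outerplanar G →
    (CopWin G ⇔ (Connected G × Chordal G))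
theorem3p9 n G outer = mk⇔ necessary sufficient
  where
    necessary : CopWin G → Connected G × Chordal G
    necessary copWin = copWin⇒connected copWin
                     , λ k 4≤k f cycle → Robber.¬copWin G outer 4≤k {f} cycle copWin

    sufficient : Connected G × Chordal G → CopWin G
    sufficient (connected , chordal) = Dismantling.connected⇒copWin G
      (λ x∈S noIsolated → OuterplanarChordal.dominated-vertex G outer chordal noIsolated x∈S) fzero connected
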